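{- Let $C$, $C'$, $P$, $Q$ be real $n\times n$ matrices. Assume: (i) $PCQ\geq PC'Q$ entrywise; (ii) $C'Qu=\lambda' Qu$ for some nonnegative column vector $u=(u_1,\ldots,u_n)^T$ and some $\lambda'\in\mathbb{R}$; (iii) $v^TPC=\lambda v^TP$ for some nonnegative row vector $v^T=(v_1,\ldots,v_n)$ and some $\lambda\in\mathbb{R}$; (iv) $v^TPQu>0$. Then $\lambda\geq\lambda'$. Moreover, $\lambda=\lambda'$ if and only if $(PC'Q)_{ij}=(PCQ)_{ij}$ for all $1\leq i,j\leq n$ with $v_i\neq 0$ and $u_j\neq 0$. -}

module Defs where

open import Data.Nat using (ℕ)
open import Data.Fin using (Fin; zero; suc)
open import Data.Product using (Σ; _×_)
open import Data.Empty using (⊥)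
open import Relation.Nullary using (¬_)
open import Relation.Binary.PropositionalEquality using (_≡_)
open import Algebra.Core using (Op₁; Op₂)
import Algebra.Structures as AS
import Relation.Binary.Structures as RS

-- The real numbers, axiomatised as a (Dedekind-)complete ordered field.
-- Any model of these axioms is isomorphic to ℝ; stdlib has no reals,
-- so the theorem is quantified over an arbitrary model.
record RealField : Set₁ where
  infixl 6 _+_
  infixl 7 _*_
  infix  4 _≤_
  field
    Carrier : Set
    _+_ _*_ : Op₂ Carrier
    -_      : Op₁ Carrier
    0# 1#   : Carrier
    _≤_     : Carrier → Carrier → Set
    isCommutativeRing : AS.IsCommutativeRing {A = Carrier} _≡_ _+_ _*_ -_ 0# 1#
    0≢1     : ¬ (0# ≡ 1#)
    inverse : (x : Carrier) → ¬ (x ≡ 0#) → Σ Carrier (λ y → x * y ≡ 1#)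
    isTotalOrder : RS.IsTotalOrder {A = Carrier} _≡_ _≤_
    +-mono-≤ : ∀ {x y} z → x ≤ y → x + z ≤ y + z
    *-nonneg : ∀ {x y} → 0# ≤ x → 0# ≤ y → 0# ≤ x * y
    sup : (S : Carrier → Set) → Σ Carrier S → Σ Carrier (λ b → ∀ x → S x → x ≤ b) →
          Σ Carrier (λ s → (∀ x → S x → x ≤ s) × (∀ b → (∀ x → S x → x ≤ b) → s ≤ b))

  _<_ : Carrier → Carrier → Set
  x < y = (x ≤ y) × ¬ (x ≡ y)

  Σ[_] : (n : ℕ) → (Fin n → Carrier) → Carrier
  Σ[ ℕ.zero ] f = 0#
  Σ[ ℕ.suc n ] f = f zero + Σ[ n ] (λ i → f (suc i))

  Matrix : ℕ → Set
  Matrix n = Fin n → Fin n → Carrier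

  Vector : ℕ → Set
  Vector n = Fin n → Carrier

  _⊗_ : ∀ {n} → Matrix n → Matrix n → Matrix n
  (A ⊗ B) i j = Σ[ _ ] (λ k → A i k * B k j)

  _·ᶜ_ : ∀ {n} → Matrix n → Vector n → Vector n
  (A ·ᶜ u) i = Σ[ _ ] (λ k → A i k * u k)

  _ʳ·_ : ∀ {n} → Vector n → Matrix n → Vector n
  (v ʳ· A) j = Σ[ _ ] (λ k → v k * A k j)

  _•_ : ∀ {n} → Carrier → Vector n → Vector n
  (c • u) i = c * u i

  dot : ∀ {n} → Vector n → Vector n → Carrier
  dot v w = Σ[ _ ] (λ k → v k * w k)

  infixl 7 _⊗_ _·ᶜ_ _ʳ·_ _•_

{-# OPTIONS --safe #-}
-- Put s = vᵀPQu > 0 and Δ = PCQ − PC'Q ≥ 0. The two eigen-equations give vᵀ(PCQ)u = λ s and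
-- vᵀ(PC'Q)u = λ' s, so (λ − λ') s = vᵀΔu = Σᵢⱼ vᵢ Δᵢⱼ uⱼ is a sum of nonnegative terms. Hence
-- λ' ≤ λ, and λ = λ' exactly when every term vanishes, i.e. when Δᵢⱼ = 0 whenever vᵢ ≠ 0 ≠ uⱼ.
-- Equality of reals is not decidable here, so "every term vanishes" is obtained from
-- ¬¬-stability of x = 0 for x ≥ 0, which is where completeness is used.
module Submission where

open import Defs
open import Data.Nat using (ℕ; zero; suc)
open import Data.Fin using (Fin; zero; suc)
open import Data.Product using (Σ; _×_; _,_; proj₁)
open import Data.Sum using (inj₁; inj₂)
open import Data.Empty using (⊥-elim)
open import Function.Bundles using (_⇔_; mk⇔)
open import Relation.Nullary using (¬_)
open import Relation.Nullary.Negation using (Stable; contradiction)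
open import Relation.Binary.PropositionalEquality
  using (_≡_; refl; sym; trans; cong; cong₂; subst; subst₂; module ≡-Reasoning)
open import Algebra.Bundles using (CommutativeRing)
import Algebra.Properties.AbelianGroup as AbelianGroupProperties
import Algebra.Properties.Ring as RingProperties
import Algebra.Properties.Semiring.Sum as SemiringSum
import Relation.Binary.Structures as RS

module RealFieldProperties (R : RealField) where
  open RealField R

  commutativeRing : CommutativeRing _ _
  commutativeRing = record { isCommutativeRing = isCommutativeRing }

  open CommutativeRing commutativeRing
    using ( +-comm; +-assoc; +-identityˡ; +-identityʳ; -‿inverseˡ; -‿inverseʳ
          ; *-comm; *-assoc; *-identityˡ; *-identityʳ; distribˡ; distribʳ; zeroˡ; zeroʳ
          ; ring; semiring; +-abelianGroup )
  open RingProperties ring using (-‿distribˡ-*; -1*x≈-x; -‿involutive)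
  open AbelianGroupProperties +-abelianGroup using (identityʳ-unique; x∙y⁻¹≈ε⇒x≈y; x≈y⇒x∙y⁻¹≈ε)
  open SemiringSum semiring using (sum; ∑-distrib-+; ∑-comm; sum-replicate-zero; *-distribˡ-sum; *-distribʳ-sum)
  open RS.IsTotalOrder isTotalOrder using (antisym; total; reflexive) renaming (trans to ≤-trans)
  open ≡-Reasoning

  infixl 6 _-_
  _-_ : Carrier → Carrier → Carrier
  x - y = x + - y

  y+[x-y]≡x : ∀ x y → y + (x - y) ≡ x
  y+[x-y]≡x x y = begin
    y + (x - y)   ≡⟨ cong (y +_) (+-comm x (- y)) ⟩
    y + (- y + x) ≡⟨ +-assoc y (- y) x ⟨
    y - y + x     ≡⟨ cong (_+ x) (-‿inverseʳ y) ⟩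
    0# + x        ≡⟨ +-identityˡ x ⟩
    x             ∎

  Σ≡sum : ∀ n (f : Fin n → Carrier) → Σ[ n ] f ≡ sum f
  Σ≡sum zero    f = refl
  Σ≡sum (suc n) f = cong (f zero +_) (Σ≡sum n (λ i → f (suc i)))

  Σ-cong : ∀ n {f g : Fin n → Carrier} → (∀ i → f i ≡ g i) → Σ[ n ] f ≡ Σ[ n ] g
  Σ-cong zero    f≡g = refl
  Σ-cong (suc n) f≡g = cong₂ _+_ (f≡g zero) (Σ-cong n (λ i → f≡g (suc i)))

  Σ-distrib-+ : ∀ n (f g : Fin n → Carrier) →
                Σ[ n ] (λ i → f i + g i) ≡ Σ[ n ] f + Σ[ n ] g
  Σ-distrib-+ n f g = begin
    Σ[ n ] (λ i → f i + g i) ≡⟨ Σ≡sum n _ ⟩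
    sum (λ i → f i + g i)    ≡⟨ ∑-distrib-+ f g ⟩
    sum f + sum g            ≡⟨ cong₂ _+_ (Σ≡sum n f) (Σ≡sum n g) ⟨
    Σ[ n ] f + Σ[ n ] g      ∎

  *-distribˡ-Σ : ∀ n c (f : Fin n → Carrier) → c * Σ[ n ] f ≡ Σ[ n ] (λ i → c * f i)
  *-distribˡ-Σ n c f = begin
    c * Σ[ n ] f            ≡⟨ cong (c *_) (Σ≡sum n f) ⟩
    c * sum f               ≡⟨ *-distribˡ-sum c f ⟩
    sum (λ i → c * f i)     ≡⟨ Σ≡sum n _ ⟨
    Σ[ n ] (λ i → c * f i)  ∎

  *-distribʳ-Σ : ∀ n c (f : Fin n → Carrier) → Σ[ n ] f * c ≡ Σ[ n ] (λ i → f i * c)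
  *-distribʳ-Σ n c f = begin
    Σ[ n ] f * c            ≡⟨ cong (_* c) (Σ≡sum n f) ⟩
    sum f * c               ≡⟨ *-distribʳ-sum c f ⟩
    sum (λ i → f i * c)     ≡⟨ Σ≡sum n _ ⟨
    Σ[ n ] (λ i → f i * c)  ∎

  Σ-comm : ∀ m n (f : Fin m → Fin n → Carrier) →
           Σ[ m ] (λ i → Σ[ n ] (f i)) ≡ Σ[ n ] (λ j → Σ[ m ] (λ i → f i j))
  Σ-comm m n f = begin
    Σ[ m ] (λ i → Σ[ n ] (f i))               ≡⟨ Σ-cong m (λ i → Σ≡sum n (f i)) ⟩
    Σ[ m ] (λ i → sum (f i))                  ≡⟨ Σ≡sum m _ ⟩
    sum (λ i → sum (f i))                     ≡⟨ ∑-comm f ⟩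
    sum (λ j → sum (λ i → f i j))             ≡⟨ Σ≡sum n _ ⟨
    Σ[ n ] (λ j → sum (λ i → f i j))          ≡⟨ Σ-cong n (λ j → Σ≡sum m (λ i → f i j)) ⟨
    Σ[ n ] (λ j → Σ[ m ] (λ i → f i j))       ∎

  Σ-zero : ∀ n → Σ[ n ] (λ _ → 0#) ≡ 0#
  Σ-zero n = trans (Σ≡sum n _) (sum-replicate-zero n)

  0<x⇒x≢0 : ∀ {x} → 0# < x → ¬ x ≡ 0#
  0<x⇒x≢0 (_ , 0≢x) x≡0 = 0≢x (sym x≡0)

  x≤y⇒0≤y-x : ∀ {x y} → x ≤ y → 0# ≤ y - x
  x≤y⇒0≤y-x {x} x≤y = subst₂ _≤_ (-‿inverseʳ x) refl (+-mono-≤ (- x) x≤y)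

  0≤y-x⇒x≤y : ∀ {x y} → 0# ≤ y - x → x ≤ y
  0≤y-x⇒x≤y {x} {y} 0≤y-x = subst₂ _≤_ (+-identityˡ x) y-x+x≡y (+-mono-≤ x 0≤y-x)
    where
    y-x+x≡y : y - x + x ≡ y
    y-x+x≡y = trans (+-assoc y (- x) x) (trans (cong (y +_) (-‿inverseˡ x)) (+-identityʳ y))

  x≤0⇒0≤-x : ∀ {x} → x ≤ 0# → 0# ≤ - x
  x≤0⇒0≤-x {x} x≤0 = subst (0# ≤_) (+-identityˡ (- x)) (x≤y⇒0≤y-x x≤0)

  0≤-x⇒x≤0 : ∀ {x} → 0# ≤ - x → x ≤ 0#
  0≤-x⇒x≤0 {x} 0≤-x = 0≤y-x⇒x≤y (subst (0# ≤_) (sym (+-identityˡ (- x))) 0≤-x)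

  x≤x+y : ∀ {x y} → 0# ≤ y → x ≤ x + y
  x≤x+y {x} {y} 0≤y = subst₂ _≤_ (+-identityˡ x) (+-comm y x) (+-mono-≤ x 0≤y)

  +-mono₂-≤ : ∀ {x y z w} → x ≤ y → z ≤ w → x + z ≤ y + w
  +-mono₂-≤ {x} {y} {z} {w} x≤y z≤w =
    ≤-trans (+-mono-≤ z x≤y) (subst₂ _≤_ (+-comm z y) (+-comm w y) (+-mono-≤ y z≤w))

  nonneg-+≡0⇒≡0 : ∀ {x y} → 0# ≤ x → 0# ≤ y → x + y ≡ 0# → x ≡ 0#
  nonneg-+≡0⇒≡0 {x} 0≤x 0≤y x+y≡0 = antisym (subst (x ≤_) x+y≡0 (x≤x+y 0≤y)) 0≤x

  0≤1 : 0# ≤ 1#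
  0≤1 with total 0# 1#
  ... | inj₁ 0≤1 = 0≤1
  ... | inj₂ 1≤0 = subst (0# ≤_) -1*-1≡1 (*-nonneg (x≤0⇒0≤-x 1≤0) (x≤0⇒0≤-x 1≤0))
    where
    -1*-1≡1 : - 1# * - 1# ≡ 1#
    -1*-1≡1 = trans (-1*x≈-x (- 1#)) (-‿involutive 1#)

  *-cancelʳ-≢0 : ∀ {s} x y → ¬ s ≡ 0# → x * s ≡ y * s → x ≡ y
  *-cancelʳ-≢0 {s} x y s≢0 xs≡ys with inverse s s≢0
  ... | t , s*t≡1 = begin
    x           ≡⟨ *-identityʳ x ⟨
    x * 1#      ≡⟨ cong (x *_) s*t≡1 ⟨
    x * (s * t) ≡⟨ *-assoc x s t ⟨
    x * s * t   ≡⟨ cong (_* t) xs≡ys ⟩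
    y * s * t   ≡⟨ *-assoc y s t ⟩
    y * (s * t) ≡⟨ cong (y *_) s*t≡1 ⟩
    y * 1#      ≡⟨ *-identityʳ y ⟩
    y           ∎

  *-cancelˡ-≢0 : ∀ {s} x y → ¬ s ≡ 0# → s * x ≡ s * y → x ≡ y
  *-cancelˡ-≢0 {s} x y s≢0 sx≡sy = *-cancelʳ-≢0 x y s≢0 (trans (*-comm x s) (trans sx≡sy (*-comm s y)))

  0≤x*s⇒0≤x : ∀ {x s} → 0# < s → 0# ≤ x * s → 0# ≤ x
  0≤x*s⇒0≤x {x} {s} 0<s 0≤xs with total 0# x
  ... | inj₁ 0≤x = 0≤x
  ... | inj₂ x≤0 = reflexive (sym (*-cancelʳ-≢0 x 0# (0<x⇒x≢0 0<s) xs≡0s))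
    where
    xs≤0 : x * s ≤ 0#
    xs≤0 = 0≤-x⇒x≤0 (subst (0# ≤_) (sym (-‿distribˡ-* x s)) (*-nonneg (x≤0⇒0≤-x x≤0) (proj₁ 0<s)))
    xs≡0s : x * s ≡ 0# * s
    xs≡0s = trans (antisym xs≤0 0≤xs) (sym (zeroˡ s))

  *-cancelʳ-≤ : ∀ {x y s} → 0# < s → x * s ≤ y * s → x ≤ y
  *-cancelʳ-≤ {x} {y} {s} 0<s xs≤ys =
    0≤y-x⇒x≤y (0≤x*s⇒0≤x 0<s (subst (0# ≤_) ys-xs≡[y-x]s (x≤y⇒0≤y-x xs≤ys)))
    where
    ys-xs≡[y-x]s : y * s - x * s ≡ (y - x) * s
    ys-xs≡[y-x]s = trans (cong (y * s +_) (-‿distribˡ-* x s)) (sym (distribʳ s y (- x)))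

  Σ-nonneg : ∀ n {f : Fin n → Carrier} → (∀ i → 0# ≤ f i) → 0# ≤ Σ[ n ] f
  Σ-nonneg zero    0≤f = reflexive refl
  Σ-nonneg (suc n) 0≤f = ≤-trans (0≤f zero) (x≤x+y (Σ-nonneg n (λ i → 0≤f (suc i))))

  Σ-nonneg-≡0 : ∀ n {f : Fin n → Carrier} → (∀ i → 0# ≤ f i) → Σ[ n ] f ≡ 0# → ∀ i → f i ≡ 0#
  Σ-nonneg-≡0 (suc n) 0≤f Σf≡0 zero =
    nonneg-+≡0⇒≡0 (0≤f zero) (Σ-nonneg n (λ i → 0≤f (suc i))) Σf≡0
  Σ-nonneg-≡0 (suc n) {f} 0≤f Σf≡0 (suc i) =
    Σ-nonneg-≡0 n (λ i → 0≤f (suc i))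
      (nonneg-+≡0⇒≡0 (Σ-nonneg n (λ i → 0≤f (suc i))) (0≤f zero) (trans (+-comm _ (f zero)) Σf≡0)) i

  two≢0 : ¬ 1# + 1# ≡ 0#
  two≢0 1+1≡0 = 0≢1 (sym (nonneg-+≡0⇒≡0 0≤1 0≤1 1+1≡0))

  halve : ∀ {e} → 0# < e → Σ Carrier (λ d → 0# < d × d + d ≡ e)
  halve {e} (0≤e , 0≢e) with inverse (1# + 1#) two≢0
  ... | h , [1+1]h≡1 = e * h , (*-nonneg 0≤e 0≤h , 0≢eh) , eh+eh≡e
    where
    h+h≡1 : h + h ≡ 1#
    h+h≡1 = trans (cong₂ _+_ (sym (*-identityˡ h)) (sym (*-identityˡ h)))
                  (trans (sym (distribʳ h 1# 1#)) [1+1]h≡1)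
    0≤h : 0# ≤ h
    0≤h with total 0# h
    ... | inj₁ 0≤h = 0≤h
    ... | inj₂ h≤0 = ⊥-elim (0≢1 (antisym 0≤1 (subst₂ _≤_ h+h≡1 (+-identityˡ 0#) (+-mono₂-≤ h≤0 h≤0))))
    eh+eh≡e : e * h + e * h ≡ e
    eh+eh≡e = trans (sym (distribˡ e h h)) (trans (cong (e *_) h+h≡1) (*-identityʳ e))
    0≢eh : ¬ 0# ≡ e * h
    0≢eh 0≡eh = 0≢e (trans (sym (+-identityˡ 0#)) (trans (cong₂ _+_ 0≡eh 0≡eh) eh+eh≡e))

  BelowPositives : Carrier → Set
  BelowPositives x = ∀ e → 0# < e → x ≤ e

  -- The supremum of the elements below every positive one is itself below every positive
  -- one, and so is its double (halve the positive); hence s + s ≤ s, i.e. s ≤ 0.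
  belowPositives⇒≤0 : ∀ {x} → BelowPositives x → x ≤ 0#
  belowPositives⇒≤0 {x} x-below
    with sup BelowPositives (0# , λ _ → proj₁) (1# , λ y y-below → y-below 1# (0≤1 , 0≢1))
  ... | s , s-ub , s-least = ≤-trans (s-ub x x-below) s≤0
    where
    s-below : BelowPositives s
    s-below e 0<e = s-least e (λ y y-below → y-below e 0<e)
    s+s-below : BelowPositives (s + s)
    s+s-below e 0<e with halve 0<e
    ... | d , 0<d , d+d≡e = subst (s + s ≤_) d+d≡e (+-mono₂-≤ (s-below d 0<d) (s-below d 0<d))
    s+s-s≡s : s + s - s ≡ s
    s+s-s≡s = trans (+-assoc s s (- s)) (trans (cong (s +_) (-‿inverseʳ s)) (+-identityʳ s))
    s≤0 : s ≤ 0#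
    s≤0 = subst₂ _≤_ s+s-s≡s (-‿inverseʳ s) (+-mono-≤ (- s) (s-ub (s + s) s+s-below))

  ≡0-stable : ∀ {x} → 0# ≤ x → Stable (x ≡ 0#)
  ≡0-stable {x} 0≤x ¬¬x≡0 = antisym (belowPositives⇒≤0 x-below) 0≤x
    where
    x-below : BelowPositives x
    x-below e (0≤e , 0≢e) with total x e
    ... | inj₁ x≤e = x≤e
    ... | inj₂ e≤x = contradiction (λ x≡0 → 0≢e (antisym 0≤e (subst (e ≤_) x≡0 e≤x))) ¬¬x≡0

  x≢0⇒y≡0⇒x*y≡0 : ∀ {x y} → 0# ≤ x * y → (¬ x ≡ 0# → y ≡ 0#) → x * y ≡ 0#
  x≢0⇒y≡0⇒x*y≡0 {x} {y} 0≤xy x≢0⇒y≡0 = ≡0-stable 0≤xy ¬¬xy≡0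
    where
    ¬¬xy≡0 : ¬ ¬ x * y ≡ 0#
    ¬¬xy≡0 xy≢0 = xy≢0 (trans (cong (x *_) (x≢0⇒y≡0 x≢0)) (zeroʳ x))
      where
      x≢0 : ¬ x ≡ 0#
      x≢0 x≡0 = xy≢0 (trans (cong (_* y) x≡0) (zeroˡ y))

  module _ {n : ℕ} where

    dot-congˡ : ∀ {a b : Vector n} (w : Vector n) → (∀ i → a i ≡ b i) → dot a w ≡ dot b w
    dot-congˡ w a≡b = Σ-cong n (λ i → cong (_* w i) (a≡b i))

    dot-congʳ : ∀ (v : Vector n) {a b : Vector n} → (∀ i → a i ≡ b i) → dot v a ≡ dot v b
    dot-congʳ v a≡b = Σ-cong n (λ i → cong (v i *_) (a≡b i))

    dot-distribˡ-+ : ∀ (a b w : Vector n) → dot (λ i → a i + b i) w ≡ dot a w + dot b w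
    dot-distribˡ-+ a b w = trans (Σ-cong n (λ i → distribʳ (w i) (a i) (b i))) (Σ-distrib-+ n _ _)

    dot-distribʳ-+ : ∀ (v a b : Vector n) → dot v (λ i → a i + b i) ≡ dot v a + dot v b
    dot-distribʳ-+ v a b = trans (Σ-cong n (λ i → distribˡ (v i) (a i) (b i))) (Σ-distrib-+ n _ _)

    dot-•ˡ : ∀ c (a b : Vector n) → dot (c • a) b ≡ c * dot a b
    dot-•ˡ c a b = trans (Σ-cong n (λ i → *-assoc c (a i) (b i))) (sym (*-distribˡ-Σ n c _))

    dot-•ʳ : ∀ c (a b : Vector n) → dot a (c • b) ≡ c * dot a b
    dot-•ʳ c a b = trans (Σ-cong n (λ i → x*[c*y]≡c*[x*y] (a i) (b i))) (sym (*-distribˡ-Σ n c _))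
      where
      x*[c*y]≡c*[x*y] : ∀ x y → x * (c * y) ≡ c * (x * y)
      x*[c*y]≡c*[x*y] x y = begin
        x * (c * y) ≡⟨ *-assoc x c y ⟨
        x * c * y   ≡⟨ cong (_* y) (*-comm x c) ⟩
        c * x * y   ≡⟨ *-assoc c x y ⟩
        c * (x * y) ∎

    dot-ʳ· : ∀ (v : Vector n) (A : Matrix n) (w : Vector n) → dot (v ʳ· A) w ≡ dot v (A ·ᶜ w)
    dot-ʳ· v A w = begin
      Σ[ n ] (λ j → Σ[ n ] (λ k → v k * A k j) * w j)   ≡⟨ Σ-cong n (λ j → *-distribʳ-Σ n (w j) _) ⟩
      Σ[ n ] (λ j → Σ[ n ] (λ k → v k * A k j * w j))   ≡⟨ Σ-comm n n _ ⟩
      Σ[ n ] (λ k → Σ[ n ] (λ j → v k * A k j * w j))   ≡⟨ Σ-cong n (λ k → Σ-cong n (λ j → *-assoc (v k) (A k j) (w j))) ⟩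
      Σ[ n ] (λ k → Σ[ n ] (λ j → v k * (A k j * w j))) ≡⟨ Σ-cong n (λ k → *-distribˡ-Σ n (v k) _) ⟨
      Σ[ n ] (λ k → v k * Σ[ n ] (λ j → A k j * w j))   ∎

    -- Definitionally, ((A ⊗ B) ·ᶜ w) i = dot (A i ʳ· B) w and (A ·ᶜ w') i = dot (A i) w'.
    ·ᶜ-⊗ : ∀ (A B : Matrix n) (w : Vector n) i → ((A ⊗ B) ·ᶜ w) i ≡ (A ·ᶜ (B ·ᶜ w)) i
    ·ᶜ-⊗ A B w i = dot-ʳ· (A i) B w

    dot-⊗⊗-·ᶜ : ∀ (v : Vector n) (A B E : Matrix n) (u : Vector n) →
                dot v ((A ⊗ B ⊗ E) ·ᶜ u) ≡ dot ((v ʳ· A) ʳ· B) (E ·ᶜ u)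
    dot-⊗⊗-·ᶜ v A B E u = begin
      dot v ((A ⊗ B ⊗ E) ·ᶜ u)       ≡⟨ dot-congʳ v (·ᶜ-⊗ (A ⊗ B) E u) ⟩
      dot v ((A ⊗ B) ·ᶜ (E ·ᶜ u))    ≡⟨ dot-congʳ v (·ᶜ-⊗ A B (E ·ᶜ u)) ⟩
      dot v (A ·ᶜ (B ·ᶜ (E ·ᶜ u)))   ≡⟨ dot-ʳ· v A _ ⟨
      dot (v ʳ· A) (B ·ᶜ (E ·ᶜ u))   ≡⟨ dot-ʳ· (v ʳ· A) B _ ⟨
      dot ((v ʳ· A) ʳ· B) (E ·ᶜ u)   ∎

    dot-nonneg : ∀ {a b : Vector n} → (∀ i → 0# ≤ a i) → (∀ i → 0# ≤ b i) → 0# ≤ dot a b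
    dot-nonneg 0≤a 0≤b = Σ-nonneg n (λ i → *-nonneg (0≤a i) (0≤b i))

    dot-·ᶜ-split : ∀ (v : Vector n) (A B D : Matrix n) (u : Vector n) → (∀ i j → A i j ≡ B i j + D i j) →
                   dot v (A ·ᶜ u) ≡ dot v (B ·ᶜ u) + dot v (D ·ᶜ u)
    dot-·ᶜ-split v A B D u A≡B+D = trans
      (dot-congʳ v (λ i → trans (dot-congˡ u (A≡B+D i)) (dot-distribˡ-+ (B i) (D i) u)))
      (dot-distribʳ-+ v _ _)

    dot-⊗⊗-·ᶜ-eigenˡ : ∀ (v : Vector n) (A B E : Matrix n) (u : Vector n) c →
                       (∀ j → ((v ʳ· A) ʳ· B) j ≡ (c • (v ʳ· A)) j) →
                       dot v ((A ⊗ B ⊗ E) ·ᶜ u) ≡ c * dot (v ʳ· A) (E ·ᶜ u)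
    dot-⊗⊗-·ᶜ-eigenˡ v A B E u c eigen = begin
      dot v ((A ⊗ B ⊗ E) ·ᶜ u)      ≡⟨ dot-⊗⊗-·ᶜ v A B E u ⟩
      dot ((v ʳ· A) ʳ· B) (E ·ᶜ u)  ≡⟨ dot-congˡ (E ·ᶜ u) eigen ⟩
      dot (c • (v ʳ· A)) (E ·ᶜ u)   ≡⟨ dot-•ˡ c (v ʳ· A) (E ·ᶜ u) ⟩
      c * dot (v ʳ· A) (E ·ᶜ u)     ∎

    dot-⊗⊗-·ᶜ-eigenʳ : ∀ (v : Vector n) (A B E : Matrix n) (u : Vector n) c →
                       (∀ i → (B ·ᶜ (E ·ᶜ u)) i ≡ (c • (E ·ᶜ u)) i) →
                       dot v ((A ⊗ B ⊗ E) ·ᶜ u) ≡ c * dot (v ʳ· A) (E ·ᶜ u)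
    dot-⊗⊗-·ᶜ-eigenʳ v A B E u c eigen = begin
      dot v ((A ⊗ B ⊗ E) ·ᶜ u)      ≡⟨ dot-⊗⊗-·ᶜ v A B E u ⟩
      dot ((v ʳ· A) ʳ· B) (E ·ᶜ u)  ≡⟨ dot-ʳ· (v ʳ· A) B (E ·ᶜ u) ⟩
      dot (v ʳ· A) (B ·ᶜ (E ·ᶜ u))  ≡⟨ dot-congʳ (v ʳ· A) eigen ⟩
      dot (v ʳ· A) (c • (E ·ᶜ u))   ≡⟨ dot-•ʳ c (v ʳ· A) (E ·ᶜ u) ⟩
      c * dot (v ʳ· A) (E ·ᶜ u)     ∎

    module _ {v u : Vector n} {D : Matrix n}
             (0≤v : ∀ i → 0# ≤ v i) (0≤D : ∀ i j → 0# ≤ D i j) (0≤u : ∀ j → 0# ≤ u j) where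

      dot-·ᶜ≡0⇒≡0 : dot v (D ·ᶜ u) ≡ 0# → ∀ i j → ¬ v i ≡ 0# → ¬ u j ≡ 0# → D i j ≡ 0#
      dot-·ᶜ≡0⇒≡0 vDu≡0 i j vi≢0 uj≢0 = *-cancelʳ-≢0 (D i j) 0# uj≢0 (trans Diju≡0 (sym (zeroˡ (u j))))
        where
        vi*Dui≡0 : v i * (D ·ᶜ u) i ≡ 0#
        vi*Dui≡0 = Σ-nonneg-≡0 n (λ i → *-nonneg (0≤v i) (dot-nonneg (0≤D i) 0≤u)) vDu≡0 i
        Dui≡0 : (D ·ᶜ u) i ≡ 0#
        Dui≡0 = *-cancelˡ-≢0 _ 0# vi≢0 (trans vi*Dui≡0 (sym (zeroʳ (v i))))
        Diju≡0 : D i j * u j ≡ 0#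
        Diju≡0 = Σ-nonneg-≡0 n (λ j → *-nonneg (0≤D i j) (0≤u j)) Dui≡0 j

      ≡0⇒dot-·ᶜ≡0 : (∀ i j → ¬ v i ≡ 0# → ¬ u j ≡ 0# → D i j ≡ 0#) → dot v (D ·ᶜ u) ≡ 0#
      ≡0⇒dot-·ᶜ≡0 D≡0 = trans (Σ-cong n vi*Dui≡0) (Σ-zero n)
        where
        Dui≡0 : ∀ i → ¬ v i ≡ 0# → (D ·ᶜ u) i ≡ 0#
        Dui≡0 i vi≢0 = trans (Σ-cong n (λ j → trans (*-comm (D i j) (u j))
                         (x≢0⇒y≡0⇒x*y≡0 (*-nonneg (0≤u j) (0≤D i j)) (D≡0 i j vi≢0))))
                       (Σ-zero n)
        vi*Dui≡0 : ∀ i → v i * (D ·ᶜ u) i ≡ 0#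
        vi*Dui≡0 i = x≢0⇒y≡0⇒x*y≡0 (*-nonneg (0≤v i) (dot-nonneg (0≤D i) 0≤u)) (Dui≡0 i)

    bilinear-comparison : ∀ {v u : Vector n} {M M' : Matrix n} {s lam lam' : Carrier} →
      (∀ i → 0# ≤ v i) → (∀ j → 0# ≤ u j) → (∀ i j → M' i j ≤ M i j) → 0# < s →
      dot v (M ·ᶜ u) ≡ lam * s → dot v (M' ·ᶜ u) ≡ lam' * s →
      (lam' ≤ lam) × ((lam ≡ lam') ⇔ (∀ i j → ¬ v i ≡ 0# → ¬ u j ≡ 0# → M' i j ≡ M i j))
    bilinear-comparison {v} {u} {M} {M'} {s} {lam} {lam'} 0≤v 0≤u M'≤M 0<s vMu≡lam*s vM'u≡lam'*s =
      *-cancelʳ-≤ 0<s (subst (lam' * s ≤_) (sym gap) (x≤x+y 0≤G)) , mk⇔ equal⇒agree agree⇒equal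
      where
      D : Matrix n
      D i j = M i j - M' i j
      G : Carrier
      G = dot v (D ·ᶜ u)
      0≤D : ∀ i j → 0# ≤ D i j
      0≤D i j = x≤y⇒0≤y-x (M'≤M i j)
      0≤G : 0# ≤ G
      0≤G = dot-nonneg 0≤v (λ i → dot-nonneg (0≤D i) 0≤u)
      gap : lam * s ≡ lam' * s + G
      gap = begin
        lam * s              ≡⟨ vMu≡lam*s ⟨
        dot v (M ·ᶜ u)       ≡⟨ dot-·ᶜ-split v M M' D u (λ i j → sym (y+[x-y]≡x (M i j) (M' i j))) ⟩
        dot v (M' ·ᶜ u) + G  ≡⟨ cong (_+ G) vM'u≡lam'*s ⟩
        lam' * s + G         ∎
      equal⇒agree : lam ≡ lam' → ∀ i j → ¬ v i ≡ 0# → ¬ u j ≡ 0# → M' i j ≡ M i j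
      equal⇒agree lam≡lam' i j vi≢0 uj≢0 =
        sym (x∙y⁻¹≈ε⇒x≈y (M i j) (M' i j) (dot-·ᶜ≡0⇒≡0 0≤v 0≤D 0≤u G≡0 i j vi≢0 uj≢0))
        where
        G≡0 : G ≡ 0#
        G≡0 = identityʳ-unique (lam' * s) G (trans (sym gap) (cong (_* s) lam≡lam'))
      agree⇒equal : (∀ i j → ¬ v i ≡ 0# → ¬ u j ≡ 0# → M' i j ≡ M i j) → lam ≡ lam'
      agree⇒equal agree = *-cancelʳ-≢0 lam lam' (0<x⇒x≢0 0<s) (begin
        lam * s         ≡⟨ gap ⟩
        lam' * s + G    ≡⟨ cong (lam' * s +_) G≡0 ⟩
        lam' * s + 0#   ≡⟨ +-identityʳ (lam' * s) ⟩
        lam' * s        ∎)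
        where
        G≡0 : G ≡ 0#
        G≡0 = ≡0⇒dot-·ᶜ≡0 0≤v 0≤D 0≤u (λ i j vi≢0 uj≢0 → x≈y⇒x∙y⁻¹≈ε (sym (agree i j vi≢0 uj≢0)))

lemma3p2 : (R : RealField) → let open RealField R in
           (n : ℕ) (C C' P Q : Matrix n) (u v : Vector n) (lam lam' : Carrier) →
           (∀ i j → (P ⊗ C' ⊗ Q) i j ≤ (P ⊗ C ⊗ Q) i j) →
           (∀ j → 0# ≤ u j) → (∀ i → (C' ·ᶜ (Q ·ᶜ u)) i ≡ (lam' • (Q ·ᶜ u)) i) →
           (∀ i → 0# ≤ v i) → (∀ j → ((v ʳ· P) ʳ· C) j ≡ (lam • (v ʳ· P)) j) →
           0# < dot (v ʳ· P) (Q ·ᶜ u) →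
           (lam' ≤ lam) ×
           ((lam ≡ lam') ⇔ (∀ i j → ¬ (v i ≡ 0#) → ¬ (u j ≡ 0#) → (P ⊗ C' ⊗ Q) i j ≡ (P ⊗ C ⊗ Q) i j))
lemma3p2 R n C C' P Q u v lam lam' PC'Q≤PCQ 0≤u C'-eigen 0≤v C-eigen 0<s =
  bilinear-comparison 0≤v 0≤u PC'Q≤PCQ 0<s
    (dot-⊗⊗-·ᶜ-eigenˡ v P C Q u lam C-eigen)
    (dot-⊗⊗-·ᶜ-eigenʳ v P C' Q u lam' C'-eigen)
  where
  open RealFieldProperties R
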